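{- Let $b$ be a positive integer. A $b$-colored partition of $n$ is a finite multiset of colored parts $r_c$, with $r\ge1$ and $c\in\{1,\dots,b\}$, whose sizes $r$ (counted with multiplicity) sum to $n$. For a $b$-colored partition $\pi$ and a positive integer $k$, let $g_k(\pi)$ be the number of colored parts $r_c$ (distinct pairs $(r,c)$) that occur at least $k$ times in $\pi$. Let $F_k(n)$ be the total number of parts of size $k$ (of any color, counted with multiplicity) in all $b$-colored partitions of $n$, and let $G_k(n)=\sum_{\pi}g_k(\pi)$, the sum over all $b$-colored partitions $\pi$ of $n$. Then for all $n=1,2,\dots$ and all $k=1,2,\dots,n$, $$F_k(n)=G_k(n).$$ -}

module Defs where

open import Data.Nat using (ℕ; zero; suc; _+_; _*_; _≤?_)
open import Data.Nat.Properties using (_≟_)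
open import Data.Fin using (Fin)
open import Data.Vec using (Vec; []; _∷_; replicate; lookup; foldr)
open import Data.List using (List; [_]; concatMap; map; upTo; filter)
open import Data.Nat.ListAction using (sum)
open import Relation.Nullary.Decidable using (⌊_⌋)
open import Data.Bool using (if_then_else_)

-- A b-colored partition of n is encoded by its multiplicity table:
-- row i (i = 0 .. n-1) gives, for each color c : Fin b, the number of
-- times the colored part (i+1)_c occurs.  Parts of size > n cannot occur
-- in a partition of n, so this encoding is a bijection with multisets.
MultTable : ℕ → ℕ → Set
MultTable b n = Vec (Vec ℕ b) n

vsum : ∀ {m} → Vec ℕ m → ℕ
vsum = foldr _ _+_ 0

vecsUpTo : ℕ → (len : ℕ) → List (Vec ℕ len)
vecsUpTo B zero = [ [] ]
vecsUpTo B (suc l) = concatMap (λ x → map (x ∷_) (vecsUpTo B l)) (upTo (suc B))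

tablesUpTo : ℕ → (b n : ℕ) → List (MultTable b n)
tablesUpTo B b zero = [ [] ]
tablesUpTo B b (suc n) =
  concatMap (λ row → map (row ∷_) (tablesUpTo B b n)) (vecsUpTo B b)

weightFrom : ∀ {b n} → ℕ → MultTable b n → ℕ
weightFrom s [] = 0
weightFrom s (row ∷ m) = s * vsum row + weightFrom (suc s) m

weight : ∀ {b n} → MultTable b n → ℕ
weight = weightFrom 1

-- the list of all b-colored partitions of n (each exactly once);
-- every multiplicity in a partition of n is at most n
partitions : (b n : ℕ) → List (MultTable b n)
partitions b n = filter (λ m → weight m ≟ n) (tablesUpTo n b n)

-- multiplicity row for part size r (r ≥ 1); all zeros if out of range
row : ∀ {b n} → MultTable b n → ℕ → Vec ℕ b
row {b} [] r = replicate b 0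
row {b} (x ∷ m) zero = replicate b 0
row (x ∷ m) (suc zero) = x
row (x ∷ m) (suc (suc r)) = row m (suc r)

partsOfSize : ∀ {b n} → ℕ → MultTable b n → ℕ
partsOfSize k m = vsum (row m k)

atLeast : ℕ → ℕ → ℕ
atLeast k x = if ⌊ k ≤? x ⌋ then 1 else 0

g : ∀ {b n} → ℕ → MultTable b n → ℕ
g k [] = 0
g k (r ∷ m) = vsum (Data.Vec.map (atLeast k) r) + g k m

F : (b k n : ℕ) → ℕ
F b k n = sum (map (partsOfSize k) (partitions b n))

G : (b k n : ℕ) → ℕ
G b k n = sum (map (g k) (partitions b n))

{-# OPTIONS --safe #-}
module Submission where

-- Removing j copies of the colored part r_c is a bijection from the b-colored partitions
-- of n having at least j such copies onto the b-colored partitions of n − rj.  Writing the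
-- number of copies of k_c as the number of j ≥ 1 with at least j copies, this gives
--   F_k(n) = Σ_c Σ_{j≥1} p_b(n − kj),   G_k(n) = Σ_r Σ_c p_b(n − rk),
-- and the two double sums agree.

open import Defs
open import Data.Nat using (ℕ; zero; suc; _+_; _*_; _≤_; _<_; _≤?_; s≤s; s≤s⁻¹)
open import Data.Nat.Properties
open import Data.Nat.ListAction using (sum)
open import Data.Nat.ListAction.Properties using (sum-++)
open import Data.Nat.Tactic.RingSolver using (solve-∀)
open import Data.Fin using (Fin; zero; suc; toℕ; fromℕ<)
open import Data.Fin.Properties using (toℕ-fromℕ<)
open import Data.Vec using (Vec; []; _∷_; lookup)
open import Data.Vec.Properties using (lookup-map)
open import Data.List using (List; []; _∷_; _++_; map; concatMap; filter; upTo; applyUpTo)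
open import Data.List.Properties using (map-++; map-∘; map-cong; map-cong-local)
open import Data.List.Relation.Unary.All as All using (All)
open import Data.List.Relation.Unary.All.Properties using (all-filter)
open import Data.Bool using (true; false; if_then_else_)
open import Function using (_∘_)
open import Relation.Nullary using (does; yes; no; contradiction)
open import Relation.Nullary.Decidable using (dec-false)
open import Relation.Unary using (Pred; Decidable)
open import Relation.Binary.PropositionalEquality
open import Algebra.Properties.CommutativeMonoid.Sum +-0-commutativeMonoid
  using (sum-syntax; sum-cong-≗; sum-replicate-zero; ∑-distrib-+; ∑-comm)

open ≡-Reasoning

private variable
  A C : Set

sumOver : List A → (A → ℕ) → ℕ
sumOver xs f = sum (map f xs)

infixl 10 sumOver
syntax sumOver xs (λ x → e) = ∑[ x ← xs ] e

sumOver-cong : ∀ (xs : List A) {f h : A → ℕ} → (∀ x → f x ≡ h x) → sumOver xs f ≡ sumOver xs h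
sumOver-cong xs f≗h = cong sum (map-cong f≗h xs)

sumOver-cong-All : ∀ {xs : List A} {f h : A → ℕ} → All (λ x → f x ≡ h x) xs → sumOver xs f ≡ sumOver xs h
sumOver-cong-All f≗h = cong sum (map-cong-local f≗h)

sumOver-zero : ∀ (xs : List A) {f : A → ℕ} → (∀ x → f x ≡ 0) → sumOver xs f ≡ 0
sumOver-zero []       f≗0 = refl
sumOver-zero (x ∷ xs) f≗0 = cong₂ _+_ (f≗0 x) (sumOver-zero xs f≗0)

sumOver-++ : ∀ (xs ys : List A) f → sumOver (xs ++ ys) f ≡ sumOver xs f + sumOver ys f
sumOver-++ xs ys f = trans (cong sum (map-++ f xs ys)) (sum-++ (map f xs) (map f ys))

sumOver-map : ∀ (h : A → C) xs f → sumOver (map h xs) f ≡ sumOver xs (f ∘ h)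
sumOver-map h xs f = cong sum (sym (map-∘ xs))

sumOver-concatMap : ∀ (h : A → List C) xs f →
  sumOver (concatMap h xs) f ≡ ∑[ x ← xs ] sumOver (h x) f
sumOver-concatMap h []       f = refl
sumOver-concatMap h (x ∷ xs) f =
  trans (sumOver-++ (h x) _ f) (cong (sumOver (h x) f +_) (sumOver-concatMap h xs f))

sumOver-filter : ∀ {ℓ} {P : Pred A ℓ} (P? : Decidable P) xs f →
  sumOver (filter P? xs) f ≡ ∑[ x ← xs ] (if does (P? x) then f x else 0)
sumOver-filter P? []       f = refl
sumOver-filter P? (x ∷ xs) f with does (P? x)
... | true  = cong (f x +_) (sumOver-filter P? xs f)
... | false = sumOver-filter P? xs f

*-distribˡ-sumOver : ∀ a (xs : List A) f → a * sumOver xs f ≡ ∑[ x ← xs ] (a * f x)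
*-distribˡ-sumOver a []       f = *-zeroʳ a
*-distribˡ-sumOver a (x ∷ xs) f =
  trans (*-distribˡ-+ a (f x) _) (cong (a * f x +_) (*-distribˡ-sumOver a xs f))

sumOver-∑ : ∀ (xs : List A) n (f : A → Fin n → ℕ) →
  ∑[ x ← xs ] ∑[ i < n ] f x i ≡ ∑[ i < n ] ∑[ x ← xs ] f x i
sumOver-∑ []       n f = sym (sum-replicate-zero n)
sumOver-∑ (x ∷ xs) n f =
  trans (cong (∑[ i < n ] f x i +_) (sumOver-∑ xs n f)) (sym (∑-distrib-+ (f x) _))

sumOver-∑∑ : ∀ (xs : List A) m n (f : A → Fin m → Fin n → ℕ) →
  ∑[ x ← xs ] ∑[ i < m ] ∑[ j < n ] f x i j ≡ ∑[ i < m ] ∑[ j < n ] ∑[ x ← xs ] f x i j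
sumOver-∑∑ xs m n f =
  trans (sumOver-∑ xs m _) (sum-cong-≗ {m} (λ i → sumOver-∑ xs n (λ x → f x i)))

sumOver-applyUpTo : ∀ (h : ℕ → A) n f → sumOver (applyUpTo h n) f ≡ ∑[ i < n ] f (h (toℕ i))
sumOver-applyUpTo h zero    f = refl
sumOver-applyUpTo h (suc n) f = cong (f (h 0) +_) (sumOver-applyUpTo (h ∘ suc) n f)

sumOver-upTo : ∀ n f → sumOver (upTo n) f ≡ ∑[ i < n ] f (toℕ i)
sumOver-upTo = sumOver-applyUpTo (λ i → i)

sumOver-cons-product : ∀ {l} (xs : List A) (ys : List (Vec A l)) (f : Vec A (suc l) → ℕ) →
  sumOver (concatMap (λ x → map (x ∷_) ys) xs) f ≡ ∑[ x ← xs ] ∑[ y ← ys ] f (x ∷ y)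
sumOver-cons-product xs ys f =
  trans (sumOver-concatMap _ xs f) (sumOver-cong xs (λ x → sumOver-map (x ∷_) ys f))

atLeast-suc : ∀ j x → atLeast (suc j) (suc x) ≡ atLeast j x
atLeast-suc j x with suc j ≤? suc x | j ≤? x
... | yes _       | yes _    = refl
... | no _        | no _     = refl
... | yes 1+j≤1+x | no j≰x  = contradiction (s≤s⁻¹ 1+j≤1+x) j≰x
... | no 1+j≰1+x | yes j≤x = contradiction (s≤s j≤x) 1+j≰1+x

∑-atLeast : ∀ {n x} → x ≤ n → ∑[ j < n ] atLeast (suc (toℕ j)) x ≡ x
∑-atLeast {zero}  {zero}  _         = refl
∑-atLeast {suc n} {zero}  _         = sum-replicate-zero n
∑-atLeast {suc n} {suc x} (s≤s x≤n) =
  cong suc (trans (sum-cong-≗ {n} (λ j → atLeast-suc (suc (toℕ j)) x)) (∑-atLeast x≤n))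

∑-trailing-zero : ∀ m (f : ℕ → ℕ) → f m ≡ 0 → ∑[ x < suc m ] f (toℕ x) ≡ ∑[ x < m ] f (toℕ x)
∑-trailing-zero zero    f fm≡0 = trans (+-identityʳ (f 0)) fm≡0
∑-trailing-zero (suc m) f fm≡0 = cong (f 0 +_) (∑-trailing-zero m (f ∘ suc) fm≡0)

∑-atLeast-shift : ∀ m j (K : ℕ → ℕ) → (∀ y → m ≤ y → K y ≡ 0) →
  ∑[ x < m ] (atLeast j (toℕ x) * K (toℕ x)) ≡ ∑[ x < m ] K (toℕ x + j)
∑-atLeast-shift m       zero    K _ = sum-cong-≗ {m} (λ x → trans (+-identityʳ _) (cong K (sym (+-identityʳ _))))
∑-atLeast-shift zero    (suc j) K _ = refl
∑-atLeast-shift (suc m) (suc j) K K-vanishes = begin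
  ∑[ x < m ] (atLeast (suc j) (suc (toℕ x)) * K (suc (toℕ x)))
    ≡⟨ sum-cong-≗ {m} (λ x → cong (_* K (suc (toℕ x))) (atLeast-suc j (toℕ x))) ⟩
  ∑[ x < m ] (atLeast j (toℕ x) * K (suc (toℕ x)))
    ≡⟨ ∑-trailing-zero m (λ x → atLeast j x * K (suc x)) last-term-vanishes ⟨
  ∑[ x < suc m ] (atLeast j (toℕ x) * K (suc (toℕ x)))
    ≡⟨ ∑-atLeast-shift (suc m) j (K ∘ suc) (λ y m<y → K-vanishes (suc y) (m≤n⇒m≤1+n m<y)) ⟩
  ∑[ x < suc m ] K (suc (toℕ x + j))
    ≡⟨ sum-cong-≗ {suc m} (λ x → cong K (+-suc (toℕ x) j)) ⟨
  ∑[ x < suc m ] K (toℕ x + suc j) ∎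
  where
  last-term-vanishes : atLeast j m * K (suc m) ≡ 0
  last-term-vanishes = trans (cong (atLeast j m *_) (K-vanishes (suc m) ≤-refl)) (*-zeroʳ (atLeast j m))

upTo-atLeast-shift : ∀ B j (K : ℕ → ℕ) → (∀ y → B < y → K y ≡ 0) →
  ∑[ x ← upTo (suc B) ] (atLeast j x * K x) ≡ ∑[ x ← upTo (suc B) ] K (x + j)
upTo-atLeast-shift B j K K-vanishes = begin
  ∑[ x ← upTo (suc B) ] (atLeast j x * K x)      ≡⟨ sumOver-upTo (suc B) _ ⟩
  ∑[ x < suc B ] (atLeast j (toℕ x) * K (toℕ x)) ≡⟨ ∑-atLeast-shift (suc B) j K K-vanishes ⟩
  ∑[ x < suc B ] K (toℕ x + j)                   ≡⟨ sumOver-upTo (suc B) _ ⟨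
  ∑[ x ← upTo (suc B) ] K (x + j)                ∎

vecsUpTo-atLeast-shift : ∀ B {l} (c : Fin l) j (H : ℕ → ℕ) → (∀ m → B < m → H m ≡ 0) →
  ∑[ v ← vecsUpTo B l ] (atLeast j (lookup v c) * H (vsum v)) ≡ ∑[ v ← vecsUpTo B l ] H (vsum v + j)
vecsUpTo-atLeast-shift B {suc l} zero j H H-vanishes = begin
  ∑[ v ← vecsUpTo B (suc l) ] (atLeast j (lookup v zero) * H (vsum v))
    ≡⟨ sumOver-cons-product (upTo (suc B)) (vecsUpTo B l) _ ⟩
  ∑[ x ← upTo (suc B) ] ∑[ w ← vecsUpTo B l ] (atLeast j x * H (x + vsum w))
    ≡⟨ sumOver-cong (upTo (suc B)) (λ x → *-distribˡ-sumOver (atLeast j x) (vecsUpTo B l) _) ⟨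
  ∑[ x ← upTo (suc B) ] (atLeast j x * K x)
    ≡⟨ upTo-atLeast-shift B j K K-vanishes ⟩
  ∑[ x ← upTo (suc B) ] K (x + j)
    ≡⟨ sumOver-cong (upTo (suc B)) (λ x → sumOver-cong (vecsUpTo B l) (λ w → cong H (+-rearrange x j (vsum w)))) ⟩
  ∑[ x ← upTo (suc B) ] ∑[ w ← vecsUpTo B l ] H (x + vsum w + j)
    ≡⟨ sumOver-cons-product (upTo (suc B)) (vecsUpTo B l) _ ⟨
  ∑[ v ← vecsUpTo B (suc l) ] H (vsum v + j) ∎
  where
  K : ℕ → ℕ
  K x = ∑[ w ← vecsUpTo B l ] H (x + vsum w)
  K-vanishes : ∀ y → B < y → K y ≡ 0
  K-vanishes y B<y = sumOver-zero (vecsUpTo B l) (λ w → H-vanishes _ (≤-trans B<y (m≤m+n y _)))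
  +-rearrange : ∀ x j w → x + j + w ≡ x + w + j
  +-rearrange = solve-∀
vecsUpTo-atLeast-shift B {suc l} (suc c) j H H-vanishes = begin
  ∑[ v ← vecsUpTo B (suc l) ] (atLeast j (lookup v (suc c)) * H (vsum v))
    ≡⟨ sumOver-cons-product (upTo (suc B)) (vecsUpTo B l) _ ⟩
  ∑[ x ← upTo (suc B) ] ∑[ w ← vecsUpTo B l ] (atLeast j (lookup w c) * H (x + vsum w))
    ≡⟨ sumOver-cong (upTo (suc B)) (λ x →
         vecsUpTo-atLeast-shift B c j (λ m → H (x + m)) (λ m B<m → H-vanishes _ (≤-trans B<m (m≤n+m m x)))) ⟩
  ∑[ x ← upTo (suc B) ] ∑[ w ← vecsUpTo B l ] H (x + (vsum w + j))
    ≡⟨ sumOver-cong (upTo (suc B)) (λ x → sumOver-cong (vecsUpTo B l) (λ w → cong H (+-assoc x (vsum w) j))) ⟨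
  ∑[ x ← upTo (suc B) ] ∑[ w ← vecsUpTo B l ] H (x + vsum w + j)
    ≡⟨ sumOver-cons-product (upTo (suc B)) (vecsUpTo B l) _ ⟨
  ∑[ v ← vecsUpTo B (suc l) ] H (vsum v + j) ∎

-- Lowering entry (i, c) by j is a bijection from the tables with that entry ≥ j onto all tables;
-- the entry bound B is harmless because Φ vanishes on the weights it would cut off.
tablesUpTo-atLeast-shift : ∀ B b {n} s (i : Fin n) (c : Fin b) j (Φ : ℕ → ℕ) → (∀ m → B < m → Φ m ≡ 0) →
  ∑[ t ← tablesUpTo B b n ] (atLeast j (lookup (lookup t i) c) * Φ (weightFrom (suc s) t))
  ≡ ∑[ t ← tablesUpTo B b n ] Φ (weightFrom (suc s) t + (suc s + toℕ i) * j)
tablesUpTo-atLeast-shift B b {suc n} s zero c j Φ Φ-vanishes = begin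
  ∑[ t ← tablesUpTo B b (suc n) ] (atLeast j (lookup (lookup t zero) c) * Φ (weightFrom (suc s) t))
    ≡⟨ sumOver-cons-product (vecsUpTo B b) (tablesUpTo B b n) _ ⟩
  ∑[ r ← vecsUpTo B b ] ∑[ w ← tablesUpTo B b n ] (atLeast j (lookup r c) * Φ (suc s * vsum r + weightFrom (2 + s) w))
    ≡⟨ sumOver-cong (vecsUpTo B b) (λ r → *-distribˡ-sumOver (atLeast j (lookup r c)) (tablesUpTo B b n) _) ⟨
  ∑[ r ← vecsUpTo B b ] (atLeast j (lookup r c) * H (vsum r))
    ≡⟨ vecsUpTo-atLeast-shift B c j H H-vanishes ⟩
  ∑[ r ← vecsUpTo B b ] H (vsum r + j)
    ≡⟨ sumOver-cong (vecsUpTo B b) (λ r → sumOver-cong (tablesUpTo B b n) (λ w →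
         cong Φ (shift-row s j (vsum r) (weightFrom (2 + s) w)))) ⟩
  ∑[ r ← vecsUpTo B b ] ∑[ w ← tablesUpTo B b n ] Φ (suc s * vsum r + weightFrom (2 + s) w + (suc s + 0) * j)
    ≡⟨ sumOver-cons-product (vecsUpTo B b) (tablesUpTo B b n) _ ⟨
  ∑[ t ← tablesUpTo B b (suc n) ] Φ (weightFrom (suc s) t + (suc s + 0) * j) ∎
  where
  H : ℕ → ℕ
  H m = ∑[ w ← tablesUpTo B b n ] Φ (suc s * m + weightFrom (2 + s) w)
  H-vanishes : ∀ m → B < m → H m ≡ 0
  H-vanishes m B<m = sumOver-zero (tablesUpTo B b n) (λ w →
    Φ-vanishes _ (≤-trans B<m (≤-trans (m≤m+n m (s * m)) (m≤m+n (suc s * m) _))))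
  shift-row : ∀ s j m w → suc s * (m + j) + w ≡ suc s * m + w + (suc s + 0) * j
  shift-row = solve-∀
tablesUpTo-atLeast-shift B b {suc n} s (suc i) c j Φ Φ-vanishes = begin
  ∑[ t ← tablesUpTo B b (suc n) ] (atLeast j (lookup (lookup t (suc i)) c) * Φ (weightFrom (suc s) t))
    ≡⟨ sumOver-cons-product (vecsUpTo B b) (tablesUpTo B b n) _ ⟩
  ∑[ r ← vecsUpTo B b ] ∑[ w ← tablesUpTo B b n ] (atLeast j (lookup (lookup w i) c) * Φ (suc s * vsum r + weightFrom (2 + s) w))
    ≡⟨ sumOver-cong (vecsUpTo B b) (λ r → tablesUpTo-atLeast-shift B b (suc s) i c j (λ m → Φ (suc s * vsum r + m))
         (λ m B<m → Φ-vanishes _ (≤-trans B<m (m≤n+m m _)))) ⟩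
  ∑[ r ← vecsUpTo B b ] ∑[ w ← tablesUpTo B b n ] Φ (suc s * vsum r + (weightFrom (2 + s) w + (2 + s + toℕ i) * j))
    ≡⟨ sumOver-cong (vecsUpTo B b) (λ r → sumOver-cong (tablesUpTo B b n) (λ w →
         cong Φ (shift-later-row s (toℕ i) j (suc s * vsum r) (weightFrom (2 + s) w)))) ⟩
  ∑[ r ← vecsUpTo B b ] ∑[ w ← tablesUpTo B b n ] Φ (suc s * vsum r + weightFrom (2 + s) w + (suc s + suc (toℕ i)) * j)
    ≡⟨ sumOver-cons-product (vecsUpTo B b) (tablesUpTo B b n) _ ⟨
  ∑[ t ← tablesUpTo B b (suc n) ] Φ (weightFrom (suc s) t + (suc s + suc (toℕ i)) * j) ∎
  where
  shift-later-row : ∀ s i j a w → a + (w + (2 + s + i) * j) ≡ a + w + (suc s + suc i) * j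
  shift-later-row = solve-∀

δ : ℕ → ℕ → ℕ
δ m n = if does (m ≟ n) then 1 else 0

if-≟-then-else-0 : ∀ m n a → (if does (m ≟ n) then a else 0) ≡ a * δ m n
if-≟-then-else-0 m n a with does (m ≟ n)
... | true  = sym (*-identityʳ a)
... | false = sym (*-zeroʳ a)

δ-vanishes : ∀ {m n} → n < m → δ m n ≡ 0
δ-vanishes {m} {n} n<m = cong (if_then 1 else 0) (dec-false (m ≟ n) (>⇒≢ n<m))

-- The number of b-colored partitions of n − m (and 0 when m > n).
#completions : (b n m : ℕ) → ℕ
#completions b n m = ∑[ t ← tablesUpTo n b n ] δ (weight t + m) n

partitions-atLeast : ∀ b n (i : Fin n) (c : Fin b) j →
  ∑[ t ← partitions b n ] atLeast j (lookup (lookup t i) c) ≡ #completions b n (suc (toℕ i) * j)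
partitions-atLeast b n i c j = begin
  ∑[ t ← partitions b n ] atLeast j (lookup (lookup t i) c)
    ≡⟨ sumOver-filter (λ t → weight t ≟ n) (tablesUpTo n b n) _ ⟩
  ∑[ t ← tablesUpTo n b n ] (if does (weight t ≟ n) then atLeast j (lookup (lookup t i) c) else 0)
    ≡⟨ sumOver-cong (tablesUpTo n b n) (λ t → if-≟-then-else-0 (weight t) n _) ⟩
  ∑[ t ← tablesUpTo n b n ] (atLeast j (lookup (lookup t i) c) * δ (weight t) n)
    ≡⟨ tablesUpTo-atLeast-shift n b 0 i c j (λ m → δ m n) (λ m → δ-vanishes) ⟩
  #completions b n (suc (toℕ i) * j) ∎

vsum≡∑ : ∀ {b} (v : Vec ℕ b) → vsum v ≡ ∑[ c < b ] lookup v c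
vsum≡∑ []      = refl
vsum≡∑ (x ∷ v) = cong (x +_) (vsum≡∑ v)

vsum-map≡∑ : ∀ {b} (f : ℕ → ℕ) (v : Vec ℕ b) → vsum (Data.Vec.map f v) ≡ ∑[ c < b ] f (lookup v c)
vsum-map≡∑ {b} f v = trans (vsum≡∑ (Data.Vec.map f v)) (sum-cong-≗ {b} (λ c → lookup-map c f v))

lookup≤vsum : ∀ {b} (v : Vec ℕ b) c → lookup v c ≤ vsum v
lookup≤vsum (x ∷ v) zero    = m≤m+n x _
lookup≤vsum (x ∷ v) (suc c) = ≤-trans (lookup≤vsum v c) (m≤n+m _ x)

vsum≤weightFrom : ∀ {b n} s (t : MultTable b n) i → vsum (lookup t i) ≤ weightFrom (suc s) t
vsum≤weightFrom s (r ∷ t) zero    = ≤-trans (m≤m+n (vsum r) (s * vsum r)) (m≤m+n _ _)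
vsum≤weightFrom s (r ∷ t) (suc i) = ≤-trans (vsum≤weightFrom (suc s) t i) (m≤n+m _ _)

row-lookup : ∀ {b n} (t : MultTable b n) i → row t (suc (toℕ i)) ≡ lookup t i
row-lookup (r ∷ t) zero    = refl
row-lookup (r ∷ t) (suc i) = row-lookup t i

partsOfSize≡∑∑ : ∀ {b n} (t : MultTable b n) i → weight t ≤ n →
  partsOfSize (suc (toℕ i)) t ≡ ∑[ c < b ] ∑[ j < n ] atLeast (suc (toℕ j)) (lookup (lookup t i) c)
partsOfSize≡∑∑ {b} {n} t i weight≤n = begin
  partsOfSize (suc (toℕ i)) t ≡⟨ cong vsum (row-lookup t i) ⟩
  vsum (lookup t i)           ≡⟨ vsum≡∑ (lookup t i) ⟩
  ∑[ c < b ] lookup (lookup t i) c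
    ≡⟨ sum-cong-≗ {b} (λ c → ∑-atLeast {n} (entry≤n c)) ⟨
  ∑[ c < b ] ∑[ j < n ] atLeast (suc (toℕ j)) (lookup (lookup t i) c) ∎
  where
  entry≤n : ∀ c → lookup (lookup t i) c ≤ n
  entry≤n c = ≤-trans (lookup≤vsum (lookup t i) c) (≤-trans (vsum≤weightFrom 0 t i) weight≤n)

g≡∑∑ : ∀ {b n} k (t : MultTable b n) → g k t ≡ ∑[ i < n ] ∑[ c < b ] atLeast k (lookup (lookup t i) c)
g≡∑∑ k []      = refl
g≡∑∑ k (r ∷ t) = cong₂ _+_ (vsum-map≡∑ (atLeast k) r) (g≡∑∑ k t)

F≡∑∑ : ∀ b n (i : Fin n) → F b (suc (toℕ i)) n ≡ ∑[ c < b ] ∑[ j < n ] #completions b n (suc (toℕ i) * suc (toℕ j))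
F≡∑∑ b n i = begin
  ∑[ t ← partitions b n ] partsOfSize (suc (toℕ i)) t
    ≡⟨ sumOver-cong-All (All.map (λ {t} weight≡n → partsOfSize≡∑∑ t i (≤-reflexive weight≡n))
                                 (all-filter (λ t → weight t ≟ n) (tablesUpTo n b n))) ⟩
  ∑[ t ← partitions b n ] ∑[ c < b ] ∑[ j < n ] atLeast (suc (toℕ j)) (lookup (lookup t i) c)
    ≡⟨ sumOver-∑∑ (partitions b n) b n _ ⟩
  ∑[ c < b ] ∑[ j < n ] ∑[ t ← partitions b n ] atLeast (suc (toℕ j)) (lookup (lookup t i) c)
    ≡⟨ sum-cong-≗ {b} (λ c → sum-cong-≗ {n} (λ j → partitions-atLeast b n i c (suc (toℕ j)))) ⟩
  ∑[ c < b ] ∑[ j < n ] #completions b n (suc (toℕ i) * suc (toℕ j)) ∎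

G≡∑∑ : ∀ b n k → G b k n ≡ ∑[ i < n ] ∑[ c < b ] #completions b n (suc (toℕ i) * k)
G≡∑∑ b n k = begin
  ∑[ t ← partitions b n ] g k t
    ≡⟨ sumOver-cong (partitions b n) (g≡∑∑ k) ⟩
  ∑[ t ← partitions b n ] ∑[ i < n ] ∑[ c < b ] atLeast k (lookup (lookup t i) c)
    ≡⟨ sumOver-∑∑ (partitions b n) n b _ ⟩
  ∑[ i < n ] ∑[ c < b ] ∑[ t ← partitions b n ] atLeast k (lookup (lookup t i) c)
    ≡⟨ sum-cong-≗ {n} (λ i → sum-cong-≗ {b} (λ c → partitions-atLeast b n i c k)) ⟩
  ∑[ i < n ] ∑[ c < b ] #completions b n (suc (toℕ i) * k) ∎

theorem2 : (b : ℕ) → 1 ≤ b → (n : ℕ) → 1 ≤ n → (k : ℕ) → 1 ≤ k → k ≤ n → F b k n ≡ G b k n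
theorem2 b _ n _ zero    () _
theorem2 b _ n _ (suc k) _  k<n = begin
  F b (suc k) n
    ≡⟨ cong (λ m → F b (suc m) n) (toℕ-fromℕ< k<n) ⟨
  F b (suc (toℕ i)) n
    ≡⟨ F≡∑∑ b n i ⟩
  ∑[ c < b ] ∑[ j < n ] #completions b n (suc (toℕ i) * suc (toℕ j))
    ≡⟨ ∑-comm {b} {n} (λ c j → #completions b n (suc (toℕ i) * suc (toℕ j))) ⟩
  ∑[ j < n ] ∑[ c < b ] #completions b n (suc (toℕ i) * suc (toℕ j))
    ≡⟨ sum-cong-≗ {n} (λ j → sum-cong-≗ {b} (λ c → cong (#completions b n) (multiplier-comm j))) ⟩
  ∑[ j < n ] ∑[ c < b ] #completions b n (suc (toℕ j) * suc k)
    ≡⟨ G≡∑∑ b n (suc k) ⟨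
  G b (suc k) n ∎
  where
  i : Fin n
  i = fromℕ< k<n
  multiplier-comm : ∀ j → suc (toℕ i) * suc (toℕ j) ≡ suc (toℕ j) * suc k
  multiplier-comm j = trans (*-comm (suc (toℕ i)) _) (cong (λ m → suc (toℕ j) * suc m) (toℕ-fromℕ< k<n))
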